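{- Let $n\ge 4$ and let $\mathcal{F}$ be a perfect separating family of $K_n$. Then $|\mathcal{F}| \ge n/2-1$.
   Context: A separating family of a graph $G$ is a multiset of total orders of $V(G)$ such that for any two disjoint edges $e,f$ some member places all vertices of one edge before all vertices of the other; it is perfect if there is a positive integer $\lambda$ such that every pair of disjoint edges is so separated by exactly $\lambda$ members (with multiplicity). $|\mathcal{F}|$ counts members with multiplicity. $K_n$ is the complete graph on $n$ vertices. -}

module Defs where

open import Data.Nat using (ℕ; suc; _<ᵇ_)
open import Data.Bool using (Bool; _∧_; _∨_)
open import Data.Fin using (Fin; toℕ)
open import Data.Fin.Permutation using (Permutation′; _⟨$⟩ʳ_)
open import Data.List using (List; length; filterᵇ)

-- A total order on V(K_n) = Fin n, given as a bijection
-- assigning to each vertex its position (rank) in the order.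
TotalOrder : ℕ → Set
TotalOrder n = Permutation′ n

before : ∀ {n} → TotalOrder n → Fin n → Fin n → Bool
before σ u v = toℕ (σ ⟨$⟩ʳ u) <ᵇ toℕ (σ ⟨$⟩ʳ v)

edgeBefore : ∀ {n} → TotalOrder n → Fin n → Fin n → Fin n → Fin n → Bool
edgeBefore σ a b c d =
  before σ a c ∧ before σ a d ∧ before σ b c ∧ before σ b d

separates : ∀ {n} → TotalOrder n → Fin n → Fin n → Fin n → Fin n → Bool
separates σ a b c d = edgeBefore σ a b c d ∨ edgeBefore σ c d a b

-- A family is a multiset of total orders, represented as a list
-- (multiplicity = number of occurrences, |F| = length).
Family : ℕ → Set
Family n = List (TotalOrder n)

sepCount : ∀ {n} → Family n → Fin n → Fin n → Fin n → Fin n → ℕ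
sepCount F a b c d = length (filterᵇ (λ σ → separates σ a b c d) F)

Distinct4 : ∀ {n} → Fin n → Fin n → Fin n → Fin n → Set
Distinct4 a b c d =
  ¬ a ≡ b × ¬ a ≡ c × ¬ a ≡ d × ¬ b ≡ c × ¬ b ≡ d × ¬ c ≡ d
  where
  open import Relation.Nullary using (¬_)
  open import Relation.Binary.PropositionalEquality using (_≡_)
  open import Data.Product using (_×_)

PerfectSeparating : ∀ n → Family n → Set
PerfectSeparating n F =
  Σ ℕ λ l → 1 ≤ l × (∀ (a b c d : Fin n) → Distinct4 a b c d → sepCount F a b c d ≡ l)
  where
  open import Data.Nat using (_≤_)
  open import Relation.Binary.PropositionalEquality using (_≡_)
  open import Data.Product using (Σ; _×_)

{-# OPTIONS --safe #-}
-- Fix a member σ of the family and let a, b be the vertices in positions 1 and 2 of σ.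
-- To every other vertex c attach the 0/1 vector in ℤ^(2|F|) recording, for each member τ,
-- whether c comes after both a and b in τ and whether it comes before both.  The inner
-- product of the vectors of c and e counts the members separating {a,b} from {c,e}: it is
-- λ when c ≠ e, while the squared norm of the vector of c exceeds λ, because σ separates
-- {a,b} from {c} but not from {c,d} for a vertex d on the other side of {a,b}.  A Gram
-- matrix λJ + D with D a positive diagonal is nonsingular, so these n − 2 vectors are
-- linearly independent and n − 2 ≤ 2|F|.
module Submission where

module IntegerVectors where

  open import Data.Nat as ℕ using (ℕ; zero; suc; z≤n)
  import Data.Nat.Properties as ℕP
  open import Data.Fin using (Fin; zero; suc; punchIn)
  open import Data.Fin.Properties using (punchInᵢ≢i; ¬∀⟶∃¬; all?)
  open import Data.Integer using (ℤ; +_; +0; +[1+_]; -[1+_]; 0ℤ; positive; 1ℤ; _+_; _*_; -_; _-_; _≤_; _<_; +≤+)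
  open import Data.Integer.Properties
  open import Data.Integer.Tactic.RingSolver using (solve-∀)
  open import Algebra.Properties.Semiring.Sum +-*-semiring
  open import Data.Vec.Functional using (insertAt; removeAt)
  open import Data.Vec.Functional.Properties using (insertAt-lookup; insertAt-punchIn)
  open import Data.Product using (_,_)
  open import Data.Sum using ([_,_]′)
  open import Relation.Binary.PropositionalEquality
  open import Relation.Nullary using (¬_; yes; no; contradiction)

  private
    variable
      N k : ℕ

  _·_ : (Fin k → ℤ) → (Fin k → ℤ) → ℤ
  u · w = ∑[ j < _ ] (u j * w j)

  combination : (Fin N → ℤ) → (Fin N → Fin k → ℤ) → Fin k → ℤ
  combination α v j = ∑[ i < _ ] (α i * v i j)

  record Dependent (v : Fin N → Fin k → ℤ) : Set where
    field
      coeff : Fin N → ℤ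
      support : Fin N
      coeff-support≢0 : coeff support ≢ 0ℤ
      combination≡0 : ∀ j → combination coeff v j ≡ 0ℤ

  sum-zero : ∀ (f : Fin N → ℤ) → (∀ i → f i ≡ 0ℤ) → sum f ≡ 0ℤ
  sum-zero {N} f f≡0 = trans (sum-cong-≗ f≡0) (sum-replicate-zero N)

  combination-scale : ∀ p (α : Fin N → ℤ) (v : Fin N → Fin k → ℤ) j →
                      combination (λ i → p * α i) v j ≡ p * combination α v j
  combination-scale p α v j = trans (sum-cong-≗ (λ i → *-assoc p (α i) (v i j)))
                                    (sym (*-distribˡ-sum p (λ i → α i * v i j)))

  combination-insertAt : ∀ (α : Fin N → ℤ) i x (v : Fin (suc N) → Fin k → ℤ) j →
                         combination (insertAt α i x) v j ≡ x * v i j + combination α (removeAt v i) j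
  combination-insertAt α i x v j = begin
    combination (insertAt α i x) v j
      ≡⟨ sum-remove (λ i′ → insertAt α i x i′ * v i′ j) ⟩
    insertAt α i x i * v i j + ∑[ t < _ ] (insertAt α i x (punchIn i t) * v (punchIn i t) j)
      ≡⟨ cong₂ (λ y z → y * v i j + z) (insertAt-lookup α i x)
               (sum-cong-≗ (λ t → cong (_* v (punchIn i t) j) (insertAt-punchIn α i x t))) ⟩
    x * v i j + combination α (removeAt v i) j ∎
    where open ≡-Reasoning

  -- Fraction-free elimination of column zero with the pivot v i zero; row i is dropped.
  eliminate : (v : Fin (suc N) → Fin (suc k) → ℤ) (i : Fin (suc N)) → Fin N → Fin k → ℤ
  eliminate v i t j = v i zero * v (punchIn i t) (suc j) - v (punchIn i t) zero * v i (suc j)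

  combination-eliminate : ∀ (β : Fin N → ℤ) (v : Fin (suc N) → Fin (suc k) → ℤ) i j →
    combination β (eliminate v i) j ≡
      v i zero * combination β (removeAt v i) (suc j) - combination β (removeAt v i) zero * v i (suc j)
  combination-eliminate β v i j = begin
    ∑[ t < _ ] (β t * (p * a t - b t * y))
      ≡⟨ sum-cong-≗ (λ t → expand (β t) p (a t) (b t) y) ⟩
    ∑[ t < _ ] (p * (β t * a t) + β t * b t * - y)
      ≡⟨ ∑-distrib-+ (λ t → p * (β t * a t)) (λ t → β t * b t * - y) ⟩
    ∑[ t < _ ] (p * (β t * a t)) + ∑[ t < _ ] (β t * b t * - y)
      ≡⟨ sym (cong₂ _+_ (*-distribˡ-sum p (λ t → β t * a t)) (*-distribʳ-sum (- y) (λ t → β t * b t))) ⟩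
    p * X + c * - y
      ≡⟨ sym (minus≡plus-neg (p * X) c y) ⟩
    p * X - c * y ∎
    where
    open ≡-Reasoning
    p = v i zero
    y = v i (suc j)
    a b : Fin _ → ℤ
    a t = v (punchIn i t) (suc j)
    b t = v (punchIn i t) zero
    X = combination β (removeAt v i) (suc j)
    c = combination β (removeAt v i) zero
    expand : ∀ β p a b y → β * (p * a - b * y) ≡ p * (β * a) + β * b * - y
    expand = solve-∀
    minus≡plus-neg : ∀ x c y → x - c * y ≡ x + c * - y
    minus≡plus-neg = solve-∀

  dependent-pivot : ∀ (v : Fin (suc N) → Fin (suc k) → ℤ) i → v i zero ≢ 0ℤ →
                    Dependent (eliminate v i) → Dependent v
  dependent-pivot v i p≢0 D = record
    { coeff = α
    ; support = punchIn i support
    ; coeff-support≢0 = λ α≡0 → [ p≢0 , coeff-support≢0 ]′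
        (i*j≡0⇒i≡0∨j≡0 p (trans (sym (insertAt-punchIn (λ t → p * β t) i (- c) support)) α≡0))
    ; combination≡0 = α-kills
    }
    where
    open Dependent D renaming (coeff to β)
    p = v i zero
    c = combination β (removeAt v i) zero
    α = insertAt (λ t → p * β t) i (- c)
    combination-α : ∀ j → combination α v j ≡ - c * v i j + p * combination β (removeAt v i) j
    combination-α j = trans (combination-insertAt (λ t → p * β t) i (- c) v j)
                            (cong (_+_ (- c * v i j)) (combination-scale p β (removeAt v i) j))
    α-kills : ∀ j → combination α v j ≡ 0ℤ
    α-kills zero = trans (combination-α zero) (cancel c p)
      where
      cancel : ∀ c p → - c * p + p * c ≡ 0ℤ
      cancel = solve-∀
    α-kills (suc j) = begin
      combination α v (suc j)                   ≡⟨ combination-α (suc j) ⟩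
      - c * y + p * X                           ≡⟨ swap c y p X ⟩
      p * X - c * y                             ≡⟨ sym (combination-eliminate β v i j) ⟩
      combination β (eliminate v i) j           ≡⟨ combination≡0 j ⟩
      0ℤ                                        ∎
      where
      open ≡-Reasoning
      y = v i (suc j)
      X = combination β (removeAt v i) (suc j)
      swap : ∀ c y p X → - c * y + p * X ≡ p * X - c * y
      swap = solve-∀

  dependent-dropColumn : ∀ (v : Fin N → Fin (suc k) → ℤ) → (∀ i → v i zero ≡ 0ℤ) →
                         Dependent (λ i j → v i (suc j)) → Dependent v
  dependent-dropColumn v column≡0 D = record
    { coeff = coeff
    ; support = support
    ; coeff-support≢0 = coeff-support≢0
    ; combination≡0 = coeff-kills
    }
    where
    open Dependent D
    coeff-kills : ∀ j → combination coeff v j ≡ 0ℤ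
    coeff-kills zero = sum-zero _ (λ i → trans (cong (coeff i *_) (column≡0 i)) (*-zeroʳ (coeff i)))
    coeff-kills (suc j) = combination≡0 j

  dim<⇒dependent : k ℕ.< N → (v : Fin N → Fin k → ℤ) → Dependent v
  dim<⇒dependent {zero} {suc N} _ v = record
    { coeff = λ _ → 1ℤ ; support = zero ; coeff-support≢0 = λ () ; combination≡0 = λ () }
  dim<⇒dependent {suc k} {suc N} k<N v with all? (λ i → v i zero ≟ 0ℤ)
  ... | yes column≡0 = dependent-dropColumn v column≡0 (dim<⇒dependent (ℕP.m<n⇒m<1+n (ℕP.<-pred k<N)) _)
  ... | no column≢0 with i , p≢0 ← ¬∀⟶∃¬ _ _ (λ i → v i zero ≟ 0ℤ) column≢0 =
    dependent-pivot v i p≢0 (dim<⇒dependent (ℕP.<-pred k<N) (eliminate v i))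

  ∑-combination-· : ∀ (α : Fin N → ℤ) (x : Fin N → Fin k → ℤ) w →
                    ∑[ c < N ] (α c * (x c · w)) ≡ combination α x · w
  ∑-combination-· α x w = begin
    ∑[ c < _ ] (α c * ∑[ j < _ ] (x c j * w j))
      ≡⟨ sum-cong-≗ (λ c → *-distribˡ-sum (α c) (λ j → x c j * w j)) ⟩
    ∑[ c < _ ] ∑[ j < _ ] (α c * (x c j * w j))
      ≡⟨ ∑-comm (λ c j → α c * (x c j * w j)) ⟩
    ∑[ j < _ ] ∑[ c < _ ] (α c * (x c j * w j))
      ≡⟨ sum-cong-≗ (λ j → trans (sum-cong-≗ (λ c → sym (*-assoc (α c) (x c j) (w j))))
                                 (sym (*-distribʳ-sum (w j) (λ c → α c * x c j)))) ⟩
    ∑[ j < _ ] (combination α x j * w j) ∎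
    where open ≡-Reasoning

  sum-nonpos : ∀ (f : Fin N → ℤ) → (∀ i → f i ≤ 0ℤ) → sum f ≤ 0ℤ
  sum-nonpos {zero} f f≤0 = ≤-refl
  sum-nonpos {suc N} f f≤0 = +-mono-≤ (f≤0 zero) (sum-nonpos (λ i → f (suc i)) (λ i → f≤0 (suc i)))

  0≤i*i : ∀ i → 0ℤ ≤ i * i
  0≤i*i +0 = ≤-refl
  0≤i*i +[1+ n ] = +≤+ z≤n
  0≤i*i -[1+ n ] = +≤+ z≤n

  i*i≤0⇒i≡0 : ∀ i → i * i ≤ 0ℤ → i ≡ 0ℤ
  i*i≤0⇒i≡0 +0 _ = refl
  i*i≤0⇒i≡0 +[1+ n ] (+≤+ ())
  i*i≤0⇒i≡0 -[1+ n ] (+≤+ ())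

  i+j≡0∧0≤j⇒i≤0 : ∀ i j → i + j ≡ 0ℤ → 0ℤ ≤ j → i ≤ 0ℤ
  i+j≡0∧0≤j⇒i≤0 i j i+j≡0 0≤j = begin
    i        ≡⟨ sym (+-identityʳ i) ⟩
    i + 0ℤ   ≤⟨ +-monoʳ-≤ i 0≤j ⟩
    i + j    ≡⟨ i+j≡0 ⟩
    0ℤ       ∎
    where open ≤-Reasoning

  uniformGram-relation : ∀ (x : Fin N → Fin k → ℤ) (l : ℕ) → (∀ c e → c ≢ e → x c · x e ≡ + l) →
    ∀ α → (∀ j → combination α x j ≡ 0ℤ) → ∀ e → α e * (x e · x e - + l) + + l * sum α ≡ 0ℤ
  uniformGram-relation {suc N} x l off α relation e = begin
    α e * (G - + l) + + l * sum α
      ≡⟨ cong (λ s → α e * (G - + l) + + l * s) (sum-remove {i = e} α) ⟩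
    α e * (G - + l) + + l * (α e + sum (removeAt α e))
      ≡⟨ regroup (α e) G (+ l) (sum (removeAt α e)) ⟩
    α e * G + sum (removeAt α e) * + l
      ≡⟨ cong (_+_ (α e * G)) (*-distribʳ-sum (+ l) (removeAt α e)) ⟩
    α e * G + ∑[ t < N ] (α (punchIn e t) * + l)
      ≡⟨ cong (_+_ (α e * G)) (sum-cong-≗ (λ t →
           cong (α (punchIn e t) *_) (sym (off (punchIn e t) e (punchInᵢ≢i e t))))) ⟩
    α e * G + ∑[ t < N ] (α (punchIn e t) * (x (punchIn e t) · x e))
      ≡⟨ sym (sum-remove (λ c → α c * (x c · x e))) ⟩
    ∑[ c < suc N ] (α c * (x c · x e))
      ≡⟨ ∑-combination-· α x (x e) ⟩
    combination α x · x e
      ≡⟨ sum-zero _ (λ j → cong (_* x e j) (relation j)) ⟩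
    0ℤ ∎
    where
    open ≡-Reasoning
    G = x e · x e
    regroup : ∀ a G l R → a * (G - l) + l * (a + R) ≡ a * G + R * l
    regroup = solve-∀

  -- Multiplying the e-th equation by ∑ α and summing over e gives (∑ α)² ≤ 0.
  α*d+l*∑α≡0⇒α≡0 : ∀ (α d : Fin N → ℤ) (l : ℕ) → (∀ e → 0ℤ < d e) →
                    (∀ e → α e * d e + + l * sum α ≡ 0ℤ) → ∀ e → α e ≡ 0ℤ
  α*d+l*∑α≡0⇒α≡0 α d l 0<d relation e =
    [ (λ α≡0 → α≡0) , (λ d≡0 → contradiction (sym d≡0) (<⇒≢ (0<d e))) ]′
      (i*j≡0⇒i≡0∨j≡0 (α e) αd≡0)
    where
    S = sum α
    αS≤0 : ∀ e → α e * S ≤ 0ℤ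
    αS≤0 e = *-cancelʳ-≤-pos (α e * S) 0ℤ (d e) {{positive (0<d e)}}
      (i+j≡0∧0≤j⇒i≤0 _ _ multiplied 0≤lS²)
      where
      0≤lS² : 0ℤ ≤ + l * (S * S)
      0≤lS² = subst (_≤ + l * (S * S)) (*-zeroʳ (+ l)) (*-monoˡ-≤-nonNeg (+ l) (0≤i*i S))
      factor : ∀ a S d l → a * S * d + l * (S * S) ≡ (a * d + l * S) * S
      factor = solve-∀
      multiplied : α e * S * d e + + l * (S * S) ≡ 0ℤ
      multiplied = trans (factor (α e) S (d e) (+ l)) (cong (_* S) (relation e))
    S≡0 : S ≡ 0ℤ
    S≡0 = i*i≤0⇒i≡0 S (subst (_≤ 0ℤ) (sym (*-distribʳ-sum S α)) (sum-nonpos _ αS≤0))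
    αd≡0 : α e * d e ≡ 0ℤ
    αd≡0 = begin
      α e * d e                ≡⟨ sym (+-identityʳ _) ⟩
      α e * d e + 0ℤ           ≡⟨ cong (_+_ (α e * d e)) (sym (trans (cong (+ l *_) S≡0) (*-zeroʳ (+ l)))) ⟩
      α e * d e + + l * S      ≡⟨ relation e ⟩
      0ℤ                       ∎
      where open ≡-Reasoning

  uniformGram⇒independent : ∀ (x : Fin N → Fin k → ℤ) (l : ℕ) →
    (∀ c e → c ≢ e → x c · x e ≡ + l) → (∀ c → + l < x c · x c) → ¬ Dependent x
  uniformGram⇒independent x l off diag D =
    coeff-support≢0 (α*d+l*∑α≡0⇒α≡0 coeff (λ e → x e · x e - + l) l 0<d
                      (uniformGram-relation x l off coeff combination≡0) support)
    where
    open Dependent D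
    0<d : ∀ e → 0ℤ < x e · x e - + l
    0<d e = subst (_< x e · x e - + l) (+-inverseʳ (+ l)) (+-monoˡ-< (- + l) (diag e))

  uniformGram⇒≤dim : ∀ (x : Fin N → Fin k → ℤ) (l : ℕ) →
    (∀ c e → c ≢ e → x c · x e ≡ + l) → (∀ c → + l < x c · x c) → N ℕ.≤ k
  uniformGram⇒≤dim {N} {k} x l off diag with N ℕ.≤? k
  ... | yes N≤k = N≤k
  ... | no N≰k = contradiction (dim<⇒dependent (ℕP.≰⇒> N≰k) x) (uniformGram⇒independent x l off diag)

module SideVectors where

  open import Defs
  open IntegerVectors using (_·_; uniformGram⇒≤dim)
  open import Data.Nat as ℕ using (ℕ; zero; suc; _<ᵇ_; s≤s)
  import Data.Nat.Properties as ℕP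
  open import Data.Bool using (Bool; true; false; _∧_; _∨_)
  open import Data.Bool.Properties using (∧-assoc; ∧-conicalˡ; ∧-commutativeMonoid)
  open import Algebra.Bundles using (CommutativeMonoid)
  open import Algebra.Properties.CommutativeSemigroup
    (CommutativeMonoid.commutativeSemigroup ∧-commutativeMonoid) using () renaming (interchange to ∧-interchange)
  open import Data.Fin using (Fin; zero; suc; toℕ)
  open import Data.Fin.Permutation using (_⟨$⟩ʳ_)
  open import Data.List using ([]; _∷_; length; filterᵇ)
  open import Data.Integer using (ℤ; +_; 0ℤ; 1ℤ; _+_; _*_; _<_; +<+)
  open import Data.Integer.Properties using (*-identityˡ; *-zeroˡ; +-identityˡ; +-assoc)
  open import Relation.Binary.PropositionalEquality

  ⟦_⟧ : Bool → ℤ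
  ⟦ true ⟧ = 1ℤ
  ⟦ false ⟧ = 0ℤ

  ⟦∧⟧ : ∀ p q → ⟦ p ∧ q ⟧ ≡ ⟦ p ⟧ * ⟦ q ⟧
  ⟦∧⟧ true q = sym (*-identityˡ ⟦ q ⟧)
  ⟦∧⟧ false q = sym (*-zeroˡ ⟦ q ⟧)

  ⟦∨⟧ : ∀ p q → (p ≡ true → q ≡ false) → ⟦ p ∨ q ⟧ ≡ ⟦ p ⟧ + ⟦ q ⟧
  ⟦∨⟧ true q disjoint rewrite disjoint refl = refl
  ⟦∨⟧ false q _ = sym (+-identityˡ ⟦ q ⟧)

  module _ {A : Set} where

    count-∷ : ∀ (p : A → Bool) x xs →
              + length (filterᵇ p (x ∷ xs)) ≡ ⟦ p x ⟧ + + length (filterᵇ p xs)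
    count-∷ p x xs with p x
    ... | true = refl
    ... | false = refl

    count-mono : ∀ (p q : A → Bool) → (∀ x → p x ≡ true → q x ≡ true) →
                 ∀ xs → length (filterᵇ p xs) ℕ.≤ length (filterᵇ q xs)
    count-mono p q p⇒q [] = ℕ.z≤n
    count-mono p q p⇒q (x ∷ xs) with p x in px | q x in qx
    ... | true | true = s≤s (count-mono p q p⇒q xs)
    ... | false | true = ℕP.m≤n⇒m≤1+n (count-mono p q p⇒q xs)
    ... | false | false = count-mono p q p⇒q xs
    ... | true | false with () ← trans (sym (p⇒q x px)) qx

    count-< : ∀ (p q : A → Bool) → (∀ x → p x ≡ true → q x ≡ true) → ∀ x xs →
              p x ≡ false → q x ≡ true → length (filterᵇ p (x ∷ xs)) ℕ.< length (filterᵇ q (x ∷ xs))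
    count-< p q p⇒q x xs px qx rewrite px | qx = s≤s (count-mono p q p⇒q xs)

  <ᵇ-asym : ∀ m n → (m <ᵇ n) ≡ true → (n <ᵇ m) ≡ false
  <ᵇ-asym zero (suc n) _ = refl
  <ᵇ-asym (suc m) (suc n) m<n = <ᵇ-asym m n m<n

  before-asym : ∀ {n} (τ : TotalOrder n) u v → before τ u v ≡ true → before τ v u ≡ false
  before-asym τ u v = <ᵇ-asym (toℕ (τ ⟨$⟩ʳ u)) (toℕ (τ ⟨$⟩ʳ v))

  module _ {n} (a b : Fin n) where

    above below : TotalOrder n → Fin n → Bool
    above τ c = before τ a c ∧ before τ b c
    below τ c = before τ c a ∧ before τ c b

    above⇒¬below : ∀ τ c → above τ c ≡ true → below τ c ≡ false
    above⇒¬below τ c ac∧bc = cong (_∧ before τ c b) (before-asym τ a c (∧-conicalˡ _ _ ac∧bc))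

    separates≡sides : ∀ τ c e → separates τ a b c e ≡ (above τ c ∧ above τ e) ∨ (below τ c ∧ below τ e)
    separates≡sides τ c e = cong₂ _∨_
      (trans (sym (∧-assoc (before τ a c) (before τ a e) _))
             (∧-interchange (before τ a c) (before τ a e) (before τ b c) (before τ b e)))
      (sym (∧-assoc (before τ c a) (before τ c b) (below τ e)))

    ⟦separates⟧ : ∀ τ c e →
      ⟦ separates τ a b c e ⟧ ≡ ⟦ above τ c ⟧ * ⟦ above τ e ⟧ + ⟦ below τ c ⟧ * ⟦ below τ e ⟧
    ⟦separates⟧ τ c e = begin
      ⟦ separates τ a b c e ⟧
        ≡⟨ cong ⟦_⟧ (separates≡sides τ c e) ⟩
      ⟦ (above τ c ∧ above τ e) ∨ (below τ c ∧ below τ e) ⟧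
        ≡⟨ ⟦∨⟧ (above τ c ∧ above τ e) (below τ c ∧ below τ e) (λ both-above →
             cong (_∧ below τ e) (above⇒¬below τ c (∧-conicalˡ _ _ both-above))) ⟩
      ⟦ above τ c ∧ above τ e ⟧ + ⟦ below τ c ∧ below τ e ⟧
        ≡⟨ cong₂ _+_ (⟦∧⟧ (above τ c) (above τ e)) (⟦∧⟧ (below τ c) (below τ e)) ⟩
      ⟦ above τ c ⟧ * ⟦ above τ e ⟧ + ⟦ below τ c ⟧ * ⟦ below τ e ⟧ ∎
      where open ≡-Reasoning

    separates⇒separates-self : ∀ τ c d → separates τ a b c d ≡ true → separates τ a b c c ≡ true
    separates⇒separates-self τ c d sep rewrite separates≡sides τ c c =
      sides⇒self (above τ c) (above τ d) (below τ c) (below τ d) (trans (sym (separates≡sides τ c d)) sep)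
      where
      sides⇒self : ∀ p q r s → (p ∧ q) ∨ (r ∧ s) ≡ true → (p ∧ p) ∨ (r ∧ r) ≡ true
      sides⇒self true q r s _ = refl
      sides⇒self false q true s _ = refl

    sideVector : (F : Family n) → Fin n → Fin (length F ℕ.* 2) → ℤ
    sideVector (τ ∷ F) c zero = ⟦ above τ c ⟧
    sideVector (τ ∷ F) c (suc zero) = ⟦ below τ c ⟧
    sideVector (τ ∷ F) c (suc (suc j)) = sideVector F c j

    sideVector-· : ∀ F c e → sideVector F c · sideVector F e ≡ + sepCount F a b c e
    sideVector-· [] c e = refl
    sideVector-· (τ ∷ F) c e = begin
      ⟦ above τ c ⟧ * ⟦ above τ e ⟧ + (⟦ below τ c ⟧ * ⟦ below τ e ⟧ + sideVector F c · sideVector F e)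
        ≡⟨ sym (+-assoc (⟦ above τ c ⟧ * ⟦ above τ e ⟧) (⟦ below τ c ⟧ * ⟦ below τ e ⟧) _) ⟩
      ⟦ above τ c ⟧ * ⟦ above τ e ⟧ + ⟦ below τ c ⟧ * ⟦ below τ e ⟧ + sideVector F c · sideVector F e
        ≡⟨ cong₂ _+_ (sym (⟦separates⟧ τ c e)) (sideVector-· F c e) ⟩
      ⟦ separates τ a b c e ⟧ + + sepCount F a b c e
        ≡⟨ sym (count-∷ (λ σ → separates σ a b c e) τ F) ⟩
      + sepCount (τ ∷ F) a b c e ∎
      where open ≡-Reasoning

    sepCount-<-self : ∀ σ F c d → separates σ a b c d ≡ false → separates σ a b c c ≡ true →
                      sepCount (σ ∷ F) a b c d ℕ.< sepCount (σ ∷ F) a b c c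
    sepCount-<-self σ F c d = count-< (λ τ → separates τ a b c d) (λ τ → separates τ a b c c)
      (λ τ → separates⇒separates-self τ c d) σ F

    uniformSeparation⇒≤2|F| : ∀ {m} (F : Family n) (l : ℕ) (ι : Fin m → Fin n) →
      (∀ s t → s ≢ t → sepCount F a b (ι s) (ι t) ≡ l) →
      (∀ t → l ℕ.< sepCount F a b (ι t) (ι t)) → m ℕ.≤ length F ℕ.* 2
    uniformSeparation⇒≤2|F| F l ι off diag = uniformGram⇒≤dim (λ t → sideVector F (ι t)) l
      (λ s t s≢t → trans (sideVector-· F (ι s) (ι t)) (cong +_ (off s t s≢t)))
      (λ t → subst (+ l <_) (sym (sideVector-· F (ι t) (ι t))) (+<+ (diag t)))

open import Defs
open SideVectors using (uniformSeparation⇒≤2|F|; sepCount-<-self)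
open import Data.Nat using (ℕ; _≤_; _+_; _*_; _<_; s≤s; z≤n)
open import Data.Nat.Properties using (+-comm; *-comm; +-monoˡ-≤; module ≤-Reasoning)
open import Data.List using (length; []; _∷_)
open import Data.Fin using (Fin; zero; suc)
open import Data.Fin.Permutation using (_⟨$⟩ʳ_; _⟨$⟩ˡ_; inverseʳ)
import Data.Fin.Permutation as Perm
open import Data.Bool using (true; false; _∧_; _∨_)
open import Data.Product using (_,_)
open import Function using (_∘_)
open import Function.Definitions using (Injective)
open import Relation.Binary.PropositionalEquality
open import Relation.Nullary using (contradiction)

Distinct4-map : ∀ {m n} {f : Fin m → Fin n} → Injective _≡_ _≡_ f →
                ∀ {a b c d} → Distinct4 a b c d → Distinct4 (f a) (f b) (f c) (f d)
Distinct4-map inj (a≢b , a≢c , a≢d , b≢c , b≢d , c≢d) =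
  a≢b ∘ inj , a≢c ∘ inj , a≢d ∘ inj , b≢c ∘ inj , b≢d ∘ inj , c≢d ∘ inj

module _ {n} (σ τ : TotalOrder n) (f : Fin n → Fin n)
         (before-f : ∀ u v → before σ (f u) (f v) ≡ before τ u v) where

  edgeBefore-relabel : ∀ a b c d → edgeBefore σ (f a) (f b) (f c) (f d) ≡ edgeBefore τ a b c d
  edgeBefore-relabel a b c d =
    cong₂ _∧_ (before-f a c) (cong₂ _∧_ (before-f a d) (cong₂ _∧_ (before-f b c) (before-f b d)))

  separates-relabel : ∀ a b c d → separates σ (f a) (f b) (f c) (f d) ≡ separates τ a b c d
  separates-relabel a b c d = cong₂ _∨_ (edgeBefore-relabel a b c d) (edgeBefore-relabel c d a b)

module _ {n} (σ : TotalOrder n) where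

  vertexAt : Fin n → Fin n
  vertexAt i = σ ⟨$⟩ˡ i

  vertexAt-injective : Injective _≡_ _≡_ vertexAt
  vertexAt-injective {i} {j} eq = trans (sym (inverseʳ σ)) (trans (cong (σ ⟨$⟩ʳ_) eq) (inverseʳ σ))

  separates-vertexAt : ∀ i j k l →
    separates σ (vertexAt i) (vertexAt j) (vertexAt k) (vertexAt l) ≡ separates Perm.id i j k l
  separates-vertexAt = separates-relabel σ Perm.id vertexAt
    (λ u v → cong₂ (before Perm.id) (inverseʳ σ) (inverseʳ σ))

-- Positions in σ: a and b sit at 1 and 2, outer enumerates the positions 0, 3, 4, …,
-- and partner t lies on the other side of {1, 2} from outer t.
module _ {n : ℕ} where

  outer : Fin (2 + n) → Fin (4 + n)
  outer zero = zero
  outer (suc t) = suc (suc (suc t))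

  partner : Fin (2 + n) → Fin (4 + n)
  partner zero = suc (suc (suc zero))
  partner (suc t) = zero

  outer-distinct : ∀ {s t} → s ≢ t → Distinct4 (suc zero) (suc (suc zero)) (outer s) (outer t)
  outer-distinct {zero} {zero} s≢t = contradiction refl s≢t
  outer-distinct {zero} {suc t} _ = (λ ()) , (λ ()) , (λ ()) , (λ ()) , (λ ()) , (λ ())
  outer-distinct {suc s} {zero} _ = (λ ()) , (λ ()) , (λ ()) , (λ ()) , (λ ()) , (λ ())
  outer-distinct {suc s} {suc t} s≢t = (λ ()) , (λ ()) , (λ ()) , (λ ()) , (λ ()) , λ { refl → s≢t refl }

  partner-distinct : ∀ t → Distinct4 (suc zero) (suc (suc zero)) (outer t) (partner t)
  partner-distinct zero = (λ ()) , (λ ()) , (λ ()) , (λ ()) , (λ ()) , (λ ())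
  partner-distinct (suc t) = (λ ()) , (λ ()) , (λ ()) , (λ ()) , (λ ()) , (λ ())

  outer-separated : ∀ t → separates Perm.id (suc zero) (suc (suc zero)) (outer t) (outer t) ≡ true
  outer-separated zero = refl
  outer-separated (suc t) = refl

  partner-unseparated : ∀ t → separates Perm.id (suc zero) (suc (suc zero)) (outer t) (partner t) ≡ false
  partner-unseparated zero = refl
  partner-unseparated (suc t) = refl

perfect⇒2+n≤2|F| : ∀ {n} σ (F : Family (4 + n)) → PerfectSeparating (4 + n) (σ ∷ F) →
                    2 + n ≤ length (σ ∷ F) * 2
perfect⇒2+n≤2|F| σ F (l , _ , perfect) =
  uniformSeparation⇒≤2|F| a b (σ ∷ F) l (V ∘ outer) off-diagonal diagonal
  where
  V = vertexAt σ
  a = V (suc zero)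
  b = V (suc (suc zero))
  distinct : ∀ {i j k l} → Distinct4 i j k l → Distinct4 (V i) (V j) (V k) (V l)
  distinct = Distinct4-map (vertexAt-injective σ)
  off-diagonal : ∀ s t → s ≢ t → sepCount (σ ∷ F) a b (V (outer s)) (V (outer t)) ≡ l
  off-diagonal s t s≢t = perfect a b (V (outer s)) (V (outer t)) (distinct (outer-distinct s≢t))
  diagonal : ∀ t → l < sepCount (σ ∷ F) a b (V (outer t)) (V (outer t))
  diagonal t = subst (_< sepCount (σ ∷ F) a b (V (outer t)) (V (outer t)))
    (perfect a b (V (outer t)) (V (partner t)) (distinct (partner-distinct t)))
    (sepCount-<-self a b σ F (V (outer t)) (V (partner t))
      (trans (separates-vertexAt σ _ _ _ _) (partner-unseparated t))
      (trans (separates-vertexAt σ _ _ _ _) (outer-separated t)))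

lemma6 : (n : ℕ) → 4 ≤ n → (F : Family n) → PerfectSeparating n F →
    n ≤ 2 * length F + 2
lemma6 _ (s≤s (s≤s (s≤s (s≤s (z≤n {n}))))) [] (l , 1≤l , perfect)
  with () ← subst (1 ≤_) (sym (perfect zero (suc zero) (suc (suc zero)) (suc (suc (suc zero)))
              ((λ ()) , (λ ()) , (λ ()) , (λ ()) , (λ ()) , (λ ())))) 1≤l
lemma6 _ (s≤s (s≤s (s≤s (s≤s (z≤n {n}))))) (σ ∷ F) perfect = begin
  4 + n                       ≡⟨ +-comm 2 (2 + n) ⟩
  2 + n + 2                   ≤⟨ +-monoˡ-≤ 2 (perfect⇒2+n≤2|F| σ F perfect) ⟩
  length (σ ∷ F) * 2 + 2      ≡⟨ cong (_+ 2) (*-comm (length (σ ∷ F)) 2) ⟩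
  2 * length (σ ∷ F) + 2      ∎
  where open ≤-Reasoning
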